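{- For every set of equations $\Theta$ and equation $\epsilon=\delta$: $\Theta\models_{\mathcal{BHA}}\epsilon=\delta$ if and only if $\{\theta_1\leftrightarrow\theta_2\mid(\theta_1=\theta_2)\in\Theta\}\vdash_s\epsilon\leftrightarrow\delta$.
   Context: Fix a countably infinite set $\mathrm{Prop}$ of propositional variables. Bi-intuitionistic formulas are generated by $\phi ::= p \mid \bot \mid \top \mid \phi\wedge\phi \mid \phi\vee\phi \mid \phi\to\phi \mid \phi\prec\phi$ with $p\in\mathrm{Prop}$ ($\prec$ is exclusion). Abbreviations: $\neg\phi := \phi\to\bot$, ${\sim}\phi := \top\prec\phi$, $\phi\leftrightarrow\psi := (\phi\to\psi)\wedge(\psi\to\phi)$. An axiom is any instance of: (A1) $\phi\to(\psi\to\phi)$; (A2) $(\phi\to(\psi\to\chi))\to((\phi\to\psi)\to(\phi\to\chi))$; (A3) $\phi\to(\phi\vee\psi)$; (A4) $\psi\to(\phi\vee\psi)$; (A5) $(\phi\to\chi)\to((\psi\to\chi)\to((\phi\vee\psi)\to\chi))$; (A6) $(\phi\wedge\psi)\to\phi$; (A7) $(\phi\wedge\psi)\to\psi$; (A8) $(\chi\to\phi)\to((\chi\to\psi)\to(\chi\to(\phi\wedge\psi)))$; (A9) $\bot\to\phi$; (A10) $\phi\to\top$; (A11) $\phi\to(\psi\vee(\phi\prec\psi))$; (A12) $(\phi\prec\psi)\to{\sim}(\phi\to\psi)$; (A13) $((\phi\prec\psi)\prec\chi)\to(\phi\prec(\psi\vee\chi))$; (A14) $\neg(\phi\prec\psi)\to(\phi\to\psi)$.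 sBIL is the relation $\Gamma\vdash_s\phi$ holding iff $\Gamma\vdash\phi$ is derivable with: (Ax) $\Gamma\vdash\phi$ for any axiom $\phi$; (El) $\Gamma\vdash\phi$ if $\phi\in\Gamma$; (MP) from $\Gamma\vdash\phi$ and $\Gamma\vdash\phi\to\psi$ infer $\Gamma\vdash\psi$; (sDN) from $\Gamma\vdash\phi$ infer $\Gamma\vdash\neg{\sim}\phi$. A bi-Heyting algebra is an algebra $(A,\top,\bot,\wedge,\vee,\to,\prec)$ whose reduct $(A,\top,\bot,\wedge,\vee)$ is a bounded lattice (order $a\le b$ iff $a=a\wedge b$) with $a\wedge b\le c\iff a\le b\to c$ and $a\le b\vee c\iff a\prec b\le c$ for all $a,b,c$; $\mathcal{BHA}$ is the class of all bi-Heyting algebras. A valuation $v:\mathrm{Prop}\to A$ extends to $\bar v$ on formulas. An equation is a pair of formulas $\phi=\psi$; $\Theta\models_{\mathcal{BHA}}\phi=\psi$ means: for all $A\in\mathcal{BHA}$ and valuations $v$ on $A$, if $\bar v(\theta)=\bar v(\eta)$ for all $(\theta=\eta)\in\Theta$ then $\bar v(\phi)=\bar v(\psi)$. -}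

module Defs where

open import Level using (Level)
open import Data.Nat using (ℕ)
open import Data.Product using (_×_; _,_; Σ)
open import Relation.Binary.PropositionalEquality using (_≡_)
open import Function.Bundles using (_⇔_)
open import Relation.Binary.Core using (Rel)
open import Algebra.Core using (Op₂)
open import Algebra.Definitions using (Congruent₂; RightIdentity)
open import Algebra.Lattice.Structures using (IsLattice)

infixr 6 _∧ᶠ_
infixr 5 _∨ᶠ_
infixr 4 _⇒_ _≺_

data Formula : Set where
  var   : ℕ → Formula
  ⊥ᶠ ⊤ᶠ : Formula
  _∧ᶠ_ _∨ᶠ_ _⇒_ _≺_ : Formula → Formula → Formula

¬ᶠ_ : Formula → Formula
¬ᶠ φ = φ ⇒ ⊥ᶠ

∼ᶠ_ : Formula → Formula
∼ᶠ φ = ⊤ᶠ ≺ φ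

_⇔ᶠ_ : Formula → Formula → Formula
φ ⇔ᶠ ψ = (φ ⇒ ψ) ∧ᶠ (ψ ⇒ φ)

data Axiom : Formula → Set where
  A1  : ∀ φ ψ → Axiom (φ ⇒ (ψ ⇒ φ))
  A2  : ∀ φ ψ χ → Axiom ((φ ⇒ (ψ ⇒ χ)) ⇒ ((φ ⇒ ψ) ⇒ (φ ⇒ χ)))
  A3  : ∀ φ ψ → Axiom (φ ⇒ (φ ∨ᶠ ψ))
  A4  : ∀ φ ψ → Axiom (ψ ⇒ (φ ∨ᶠ ψ))
  A5  : ∀ φ ψ χ → Axiom ((φ ⇒ χ) ⇒ ((ψ ⇒ χ) ⇒ ((φ ∨ᶠ ψ) ⇒ χ)))
  A6  : ∀ φ ψ → Axiom ((φ ∧ᶠ ψ) ⇒ φ)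
  A7  : ∀ φ ψ → Axiom ((φ ∧ᶠ ψ) ⇒ ψ)
  A8  : ∀ φ ψ χ → Axiom ((χ ⇒ φ) ⇒ ((χ ⇒ ψ) ⇒ (χ ⇒ (φ ∧ᶠ ψ))))
  A9  : ∀ φ → Axiom (⊥ᶠ ⇒ φ)
  A10 : ∀ φ → Axiom (φ ⇒ ⊤ᶠ)
  A11 : ∀ φ ψ → Axiom (φ ⇒ (ψ ∨ᶠ (φ ≺ ψ)))
  A12 : ∀ φ ψ → Axiom ((φ ≺ ψ) ⇒ (∼ᶠ (φ ⇒ ψ)))
  A13 : ∀ φ ψ χ → Axiom (((φ ≺ ψ) ≺ χ) ⇒ (φ ≺ (ψ ∨ᶠ χ)))
  A14 : ∀ φ ψ → Axiom ((¬ᶠ (φ ≺ ψ)) ⇒ (φ ⇒ ψ))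

FormulaSet : Set₁
FormulaSet = Formula → Set

infix 2 _⊢ₛ_

data _⊢ₛ_ (Γ : FormulaSet) : Formula → Set where
  ax  : ∀ {φ} → Axiom φ → Γ ⊢ₛ φ
  el  : ∀ {φ} → Γ φ → Γ ⊢ₛ φ
  mp  : ∀ {φ ψ} → Γ ⊢ₛ φ → Γ ⊢ₛ (φ ⇒ ψ) → Γ ⊢ₛ ψ
  sDN : ∀ {φ} → Γ ⊢ₛ φ → Γ ⊢ₛ (¬ᶠ (∼ᶠ φ))

record BiHeytingAlgebra (c ℓ : _) : Set (Level.suc (c Level.⊔ ℓ)) where
  infix 4 _≈_ _≤_
  field
    Carrier : Set c
    _≈_     : Rel Carrier ℓ
    ⊤ ⊥     : Carrier
    _∧_ _∨_ _→ᵃ_ _≺ᵃ_ : Op₂ Carrier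
    isLattice : IsLattice _≈_ _∨_ _∧_
    ⊤-identityʳ : RightIdentity _≈_ ⊤ _∧_    -- a ∧ ⊤ = a  (a ≤ ⊤)
    ⊥-identityʳ : RightIdentity _≈_ ⊥ _∨_    -- a ∨ ⊥ = a  (⊥ ≤ a)
    →-cong  : Congruent₂ _≈_ _→ᵃ_
    ≺-cong  : Congruent₂ _≈_ _≺ᵃ_

  _≤_ : Carrier → Carrier → Set ℓ
  a ≤ b = a ≈ (a ∧ b)

  field
    residuation   : ∀ a b c → ((a ∧ b) ≤ c) ⇔ (a ≤ (b →ᵃ c))
    coresiduation : ∀ a b c → (a ≤ (b ∨ c)) ⇔ ((a ≺ᵃ b) ≤ c)

  open IsLattice isLattice public

module _ {c ℓ : Level} (A : BiHeytingAlgebra c ℓ) where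
  open BiHeytingAlgebra A

  Valuation : Set c
  Valuation = ℕ → Carrier

  ⟦_⟧ : Formula → Valuation → Carrier
  ⟦ var p ⟧   v = v p
  ⟦ ⊥ᶠ ⟧      v = ⊥
  ⟦ ⊤ᶠ ⟧      v = ⊤
  ⟦ φ ∧ᶠ ψ ⟧  v = ⟦ φ ⟧ v ∧ ⟦ ψ ⟧ v
  ⟦ φ ∨ᶠ ψ ⟧  v = ⟦ φ ⟧ v ∨ ⟦ ψ ⟧ v
  ⟦ φ ⇒ ψ ⟧   v = ⟦ φ ⟧ v →ᵃ ⟦ ψ ⟧ v
  ⟦ φ ≺ ψ ⟧   v = ⟦ φ ⟧ v ≺ᵃ ⟦ ψ ⟧ v

Equation : Set
Equation = Formula × Formula

EquationSet : Set₁
EquationSet = Equation → Set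

infix 2 _⊨BHA_≐_
_⊨BHA_≐_ : EquationSet → Formula → Formula → Set₁
Θ ⊨BHA ε ≐ δ =
  (A : BiHeytingAlgebra Level.zero Level.zero) (v : Valuation A) →
  (∀ θ η → Θ (θ , η) →
     BiHeytingAlgebra._≈_ A (⟦_⟧ A θ v) (⟦_⟧ A η v)) →
  BiHeytingAlgebra._≈_ A (⟦_⟧ A ε v) (⟦_⟧ A δ v)

biconds : EquationSet → FormulaSet
biconds Θ φ = Σ Formula λ θ₁ → Σ Formula λ θ₂ → Θ (θ₁ , θ₂) × (φ ≡ (θ₁ ⇔ᶠ θ₂))

-- Soundness: every axiom denotes ⊤ in every bi-Heyting algebra, modus ponens
-- preserves this, and so does sDN, because ⊤ ≤ a ∨ ⊥ gives ⊤ ≺ a ≤ ⊥.  An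
-- equation a = b holds exactly when ⊤ ≤ (a → b) ∧ (b → a), so valuations
-- satisfying Θ validate the biconditionals of Θ and hence all their
-- consequences.
--
-- Completeness: formulas ordered by provable implication from the
-- biconditionals of Θ form a bi-Heyting algebra (the Lindenbaum–Tarski
-- algebra).  Under the valuation p ↦ p each formula denotes itself, so an
-- equation holds there iff its biconditional is provable.  The Heyting laws
-- come from the deduction theorem of the sDN-free calculus; sDN is needed
-- exactly for the coresiduation law a → b ∨ c ⟹ (a ≺ b) → c.

module Submission where

open import Defs
open import Algebra.Core using (Op₂)
open import Algebra.Lattice.Bundles using (Lattice)
open import Data.List using (List; []; _∷_)
open import Data.List.Membership.Propositional using (_∈_)
open import Data.List.Relation.Unary.All using (All; []; _∷_; lookup)
open import Data.List.Relation.Unary.Any using (here; there)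
open import Data.Product using (_,_)
open import Function.Base using (flip)
open import Function.Bundles using (_⇔_; mk⇔; Equivalence)
open import Function.Construct.Composition using (_⇔-∘_)
open import Function.Construct.Identity using (⇔-id)
open import Function.Construct.Symmetry using (⇔-sym)
open import Level using (0ℓ; _⊔_)
open import Relation.Binary.Core using (_Preserves₂_⟶_⟶_)
open import Relation.Binary.Lattice.Bundles using (HeytingAlgebra)
open import Relation.Binary.Lattice.Structures using (IsLattice)
open import Relation.Binary.Structures using (IsPartialOrder)
open import Relation.Binary.PropositionalEquality as ≡ using (_≡_; cong₂)

module Heyting {c ℓ₁ ℓ₂} (H : HeytingAlgebra c ℓ₁ ℓ₂) where
  open HeytingAlgebra H
  open import Relation.Binary.Lattice.Properties.MeetSemilattice meetSemilattice
    using (∧-monotonic)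
  open import Relation.Binary.Lattice.Properties.HeytingAlgebra H using (⇨-eval)

  ≤⇔≈∧ : ∀ {x y} → x ≤ y ⇔ x ≈ x ∧ y
  ≤⇔≈∧ = mk⇔ (λ x≤y → antisym (∧-greatest refl x≤y) (x∧y≤x _ _))
             (λ x≈x∧y → trans (reflexive x≈x∧y) (x∧y≤y _ _))

  ⊤≤x⇨y⇔x≤y : ∀ {x y} → ⊤ ≤ x ⇨ y ⇔ x ≤ y
  ⊤≤x⇨y⇔x≤y {x} = mk⇔ (λ ⊤≤x⇨y → trans (∧-greatest (maximum x) refl) (transpose-∧ ⊤≤x⇨y))
                      (λ x≤y → transpose-⇨ (trans (x∧y≤y _ _) x≤y))

  ⊤≤x⇔y⇔x≈y : ∀ {x y} → ⊤ ≤ (x ⇨ y) ∧ (y ⇨ x) ⇔ x ≈ y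
  ⊤≤x⇔y⇔x≈y = mk⇔
    (λ ⊤≤x⇔y → antisym (to ⊤≤x⇨y⇔x≤y (trans ⊤≤x⇔y (x∧y≤x _ _)))
                       (to ⊤≤x⇨y⇔x≤y (trans ⊤≤x⇔y (x∧y≤y _ _))))
    (λ x≈y → ∧-greatest (from ⊤≤x⇨y⇔x≤y (reflexive x≈y))
                        (from ⊤≤x⇨y⇔x≤y (reflexive (Eq.sym x≈y))))
    where open Equivalence

  ⇨-distribˡ-⇨-≤ : ∀ {x y z} → x ⇨ (y ⇨ z) ≤ (x ⇨ y) ⇨ (x ⇨ z)
  ⇨-distribˡ-⇨-≤ = transpose-⇨ (transpose-⇨ (trans
    (∧-greatest (∧-monotonic (x∧y≤x _ _) refl) (∧-monotonic (x∧y≤y _ _) refl))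
    (trans (∧-monotonic ⇨-eval ⇨-eval) ⇨-eval)))

Coresiduation : ∀ {c ℓ₁ ℓ₂} (H : HeytingAlgebra c ℓ₁ ℓ₂) →
                Op₂ (HeytingAlgebra.Carrier H) → Set (c ⊔ ℓ₂)
Coresiduation H _≺ᵃ_ = ∀ x y z → x ≤ y ∨ z ⇔ (x ≺ᵃ y) ≤ z
  where open HeytingAlgebra H

module BiHeyting {c ℓ₁ ℓ₂} (H : HeytingAlgebra c ℓ₁ ℓ₂)
  (_≺ᵃ_ : Op₂ (HeytingAlgebra.Carrier H)) (coresiduation : Coresiduation H _≺ᵃ_) where
  open HeytingAlgebra H
  open Equivalence
  open import Relation.Binary.Lattice.Properties.JoinSemilattice joinSemilattice
    using (∨-monotonic; ∨-assoc)
  open import Relation.Binary.Lattice.Properties.MeetSemilattice meetSemilattice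
    using (∧-monotonic)
  open import Relation.Binary.Lattice.Properties.HeytingAlgebra H
    using (⇨-eval; ⇨-applyʳ; ∧-distribˡ-∨-≤; ⇨-cong)
  open import Relation.Binary.Reasoning.PartialOrder poset

  transpose-≺ : ∀ {x y z} → x ≤ y ∨ z → x ≺ᵃ y ≤ z
  transpose-≺ {x} {y} {z} = to (coresiduation x y z)

  transpose-∨ : ∀ {x y z} → x ≺ᵃ y ≤ z → x ≤ y ∨ z
  transpose-∨ {x} {y} {z} = from (coresiduation x y z)

  x≤y∨x≺y : ∀ {x y} → x ≤ y ∨ (x ≺ᵃ y)
  x≤y∨x≺y = transpose-∨ refl

  ≺-monotonic : _≺ᵃ_ Preserves₂ _≤_ ⟶ flip _≤_ ⟶ _≤_
  ≺-monotonic x≤x′ y′≤y = transpose-≺ (trans x≤x′ (trans x≤y∨x≺y (∨-monotonic y′≤y refl)))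

  ≺-cong : _≺ᵃ_ Preserves₂ _≈_ ⟶ _≈_ ⟶ _≈_
  ≺-cong x≈x′ y≈y′ = antisym
    (≺-monotonic (reflexive x≈x′) (reflexive (Eq.sym y≈y′)))
    (≺-monotonic (reflexive (Eq.sym x≈x′)) (reflexive y≈y′))

  x≺y≤∼x⇨y : ∀ {x y} → x ≺ᵃ y ≤ ⊤ ≺ᵃ (x ⇨ y)
  x≺y≤∼x⇨y {x} {y} = transpose-≺ (begin
    x                                   ≤⟨ ∧-greatest refl (trans (maximum x) x≤y∨x≺y) ⟩
    x ∧ ((x ⇨ y) ∨ (⊤ ≺ᵃ (x ⇨ y)))      ≤⟨ ∧-distribˡ-∨-≤ _ _ _ ⟩
    x ∧ (x ⇨ y) ∨ x ∧ (⊤ ≺ᵃ (x ⇨ y))    ≤⟨ ∨-monotonic (⇨-applyʳ refl) (x∧y≤y _ _) ⟩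
    y ∨ (⊤ ≺ᵃ (x ⇨ y))                  ∎)

  x≺y≺z≤x≺y∨z : ∀ {x y z} → (x ≺ᵃ y) ≺ᵃ z ≤ x ≺ᵃ (y ∨ z)
  x≺y≺z≤x≺y∨z = transpose-≺ (transpose-≺ (trans x≤y∨x≺y (reflexive (∨-assoc _ _ _))))

  ¬x≺y≤x⇨y : ∀ {x y} → (x ≺ᵃ y) ⇨ ⊥ ≤ x ⇨ y
  ¬x≺y≤x⇨y {x} {y} = transpose-⇨ (begin
    ((x ≺ᵃ y) ⇨ ⊥) ∧ x                              ≤⟨ ∧-monotonic refl x≤y∨x≺y ⟩
    ((x ≺ᵃ y) ⇨ ⊥) ∧ (y ∨ (x ≺ᵃ y))                 ≤⟨ ∧-distribˡ-∨-≤ _ _ _ ⟩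
    ((x ≺ᵃ y) ⇨ ⊥) ∧ y ∨ ((x ≺ᵃ y) ⇨ ⊥) ∧ (x ≺ᵃ y)  ≤⟨ ∨-least (x∧y≤y _ _) (trans ⇨-eval (minimum y)) ⟩
    y                                               ∎)

  biHeytingAlgebra : BiHeytingAlgebra c ℓ₁
  biHeytingAlgebra = record
    { Carrier = Carrier
    ; _≈_ = _≈_
    ; ⊤ = ⊤ ; ⊥ = ⊥
    ; _∧_ = _∧_ ; _∨_ = _∨_ ; _→ᵃ_ = _⇨_ ; _≺ᵃ_ = _≺ᵃ_
    ; isLattice = isAlgLattice
    ; ⊤-identityʳ = λ x → antisym (x∧y≤x _ _) (∧-greatest refl (maximum x))
    ; ⊥-identityʳ = λ x → antisym (∨-least refl (minimum x)) (x≤x∨y _ _)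
    ; →-cong = ⇨-cong
    ; ≺-cong = ≺-cong
    ; residuation = λ x y z → let curry , uncurry = exponential x y z in natural (mk⇔ curry uncurry)
    ; coresiduation = λ x y z → natural (coresiduation x y z)
    }
    where
    open import Relation.Binary.Lattice.Properties.Lattice lattice using (isAlgLattice)
    open Heyting H using (≤⇔≈∧)
    natural : ∀ {x y x′ y′} → x ≤ y ⇔ x′ ≤ y′ → x ≈ x ∧ y ⇔ x′ ≈ x′ ∧ y′
    natural e = ≤⇔≈∧ ⇔-∘ (e ⇔-∘ ⇔-sym ≤⇔≈∧)

-- The order of ∨-∧-isOrderTheoreticLattice is x ≈ x ∧ y, definitionally
-- BiHeytingAlgebra._≤_; so residuation is an exponential as it stands, and
-- coresiduation a Coresiduation.
module _ {c ℓ} (A : BiHeytingAlgebra c ℓ) where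
  private
    module A = BiHeytingAlgebra A

    algebraicLattice : Lattice c ℓ
    algebraicLattice = record { isLattice = A.isLattice }

    open import Algebra.Lattice.Properties.Lattice algebraicLattice
      using (∨-∧-isOrderTheoreticLattice)

  heytingAlgebra : HeytingAlgebra c ℓ ℓ
  heytingAlgebra = record
    { isHeytingAlgebra = record
      { isBoundedLattice = record
        { isLattice = ∨-∧-isOrderTheoreticLattice
        ; maximum = λ x → A.sym (A.⊤-identityʳ x)
        ; minimum = λ x → ≤-respʳ-≈ (A.⊥-identityʳ x) (y≤x∨y x A.⊥)
        }
      ; exponential = λ x y z → let open Equivalence (A.residuation x y z) in to , from
      }
    }
    where open IsLattice ∨-∧-isOrderTheoreticLattice using (≤-respʳ-≈; y≤x∨y)

module _ {c ℓ} (A : BiHeytingAlgebra c ℓ) where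
  private
    H = heytingAlgebra A
    open HeytingAlgebra H
    open Heyting H
    open BiHeyting H (BiHeytingAlgebra._≺ᵃ_ A) (BiHeytingAlgebra.coresiduation A)
    open Equivalence
    open import Relation.Binary.Lattice.Properties.HeytingAlgebra H
      using (y≤x⇨y; ⇨-distribˡ-∨-∧-≥; ⇨-distribˡ-∧-≥)

    ⇨-valid : ∀ {x y} → x ≤ y → ⊤ ≤ x ⇨ y
    ⇨-valid = from ⊤≤x⇨y⇔x≤y

  axiom-valid : ∀ {φ} → Axiom φ → ∀ v → ⊤ ≤ ⟦ A ⟧ φ v
  axiom-valid (A1 φ ψ)    v = ⇨-valid y≤x⇨y
  axiom-valid (A2 φ ψ χ)  v = ⇨-valid ⇨-distribˡ-⇨-≤
  axiom-valid (A3 φ ψ)    v = ⇨-valid (x≤x∨y _ _)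
  axiom-valid (A4 φ ψ)    v = ⇨-valid (y≤x∨y _ _)
  axiom-valid (A5 φ ψ χ)  v = ⇨-valid (transpose-⇨ (⇨-distribˡ-∨-∧-≥ _ _ _))
  axiom-valid (A6 φ ψ)    v = ⇨-valid (x∧y≤x _ _)
  axiom-valid (A7 φ ψ)    v = ⇨-valid (x∧y≤y _ _)
  axiom-valid (A8 φ ψ χ)  v = ⇨-valid (transpose-⇨ (⇨-distribˡ-∧-≥ _ _ _))
  axiom-valid (A9 φ)      v = ⇨-valid (minimum _)
  axiom-valid (A10 φ)     v = ⇨-valid (maximum _)
  axiom-valid (A11 φ ψ)   v = ⇨-valid x≤y∨x≺y
  axiom-valid (A12 φ ψ)   v = ⇨-valid x≺y≤∼x⇨y
  axiom-valid (A13 φ ψ χ) v = ⇨-valid x≺y≺z≤x≺y∨z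
  axiom-valid (A14 φ ψ)   v = ⇨-valid ¬x≺y≤x⇨y

  soundness : ∀ {Γ φ} v → (∀ {ψ} → Γ ψ → ⊤ ≤ ⟦ A ⟧ ψ v) → Γ ⊢ₛ φ → ⊤ ≤ ⟦ A ⟧ φ v
  soundness v valid-Γ (ax a)   = axiom-valid a v
  soundness v valid-Γ (el ψ∈Γ) = valid-Γ ψ∈Γ
  soundness v valid-Γ (mp ⊢φ ⊢φ⇒ψ) =
    trans (soundness v valid-Γ ⊢φ) (to ⊤≤x⇨y⇔x≤y (soundness v valid-Γ ⊢φ⇒ψ))
  soundness v valid-Γ (sDN ⊢φ) =
    ⇨-valid (transpose-≺ (trans (soundness v valid-Γ ⊢φ) (x≤x∨y _ _)))

-- The deduction theorem fails for sBIL (p ⊢ₛ ¬∼p, but p → ¬∼p is not a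
-- theorem), so propositional reasoning is done in the sDN-free calculus over
-- finite lists of hypotheses and then instantiated with sBIL proofs.
infix 2 _⊢_

data _⊢_ (Δ : List Formula) : Formula → Set where
  ax  : ∀ {φ} → Axiom φ → Δ ⊢ φ
  hyp : ∀ {φ} → φ ∈ Δ → Δ ⊢ φ
  mp  : ∀ {φ ψ} → Δ ⊢ φ → Δ ⊢ φ ⇒ ψ → Δ ⊢ ψ

instantiate : ∀ {Γ Δ φ} → All (Γ ⊢ₛ_) Δ → Δ ⊢ φ → Γ ⊢ₛ φ
instantiate ⊢Δ (ax a)       = ax a
instantiate ⊢Δ (hyp φ∈Δ)    = lookup ⊢Δ φ∈Δ
instantiate ⊢Δ (mp ⊢φ ⊢φ⇒ψ) = mp (instantiate ⊢Δ ⊢φ) (instantiate ⊢Δ ⊢φ⇒ψ)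

module _ {Δ : List Formula} where

  hyp₀ : ∀ {φ} → φ ∷ Δ ⊢ φ
  hyp₀ = hyp (here ≡.refl)

  hyp₁ : ∀ {φ ψ} → ψ ∷ φ ∷ Δ ⊢ φ
  hyp₁ = hyp (there (here ≡.refl))

  hyp₂ : ∀ {φ ψ χ} → χ ∷ ψ ∷ φ ∷ Δ ⊢ φ
  hyp₂ = hyp (there (there (here ≡.refl)))

  weaken : ∀ {φ ψ} → Δ ⊢ φ → ψ ∷ Δ ⊢ φ
  weaken (ax a)       = ax a
  weaken (hyp φ∈Δ)    = hyp (there φ∈Δ)
  weaken (mp ⊢φ ⊢φ⇒ψ) = mp (weaken ⊢φ) (weaken ⊢φ⇒ψ)

  ⇒-refl : ∀ {φ} → Δ ⊢ φ ⇒ φ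
  ⇒-refl {φ} = mp (ax (A1 φ φ)) (mp (ax (A1 φ (φ ⇒ φ))) (ax (A2 φ (φ ⇒ φ) φ)))

deduction : ∀ {Δ φ ψ} → φ ∷ Δ ⊢ ψ → Δ ⊢ φ ⇒ ψ
deduction {φ = φ} (ax {ψ} a)              = mp (ax a) (ax (A1 ψ φ))
deduction         (hyp (here ≡.refl))     = ⇒-refl
deduction {φ = φ} (hyp {ψ} (there ψ∈Δ))   = mp (hyp ψ∈Δ) (ax (A1 ψ φ))
deduction {φ = φ} (mp {χ} {ψ} ⊢χ ⊢χ⇒ψ)    =
  mp (deduction ⊢χ) (mp (deduction ⊢χ⇒ψ) (ax (A2 φ χ ψ)))

module _ {Δ : List Formula} where

  ⇒-elim : ∀ {φ ψ} → Δ ⊢ φ ⇒ ψ → Δ ⊢ φ → Δ ⊢ ψ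
  ⇒-elim ⊢φ⇒ψ ⊢φ = mp ⊢φ ⊢φ⇒ψ

  ∧-intro : ∀ {φ ψ} → Δ ⊢ φ → Δ ⊢ ψ → Δ ⊢ φ ∧ᶠ ψ
  ∧-intro {φ} {ψ} ⊢φ ⊢ψ = mp ⊢φ (mp (deduction (weaken ⊢ψ)) (mp ⇒-refl (ax (A8 φ ψ φ))))

  ∧-elimˡ : ∀ {φ ψ} → Δ ⊢ φ ∧ᶠ ψ → Δ ⊢ φ
  ∧-elimˡ {φ} {ψ} ⊢φ∧ψ = mp ⊢φ∧ψ (ax (A6 φ ψ))

  ∧-elimʳ : ∀ {φ ψ} → Δ ⊢ φ ∧ᶠ ψ → Δ ⊢ ψ
  ∧-elimʳ {φ} {ψ} ⊢φ∧ψ = mp ⊢φ∧ψ (ax (A7 φ ψ))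

  ∨-introˡ : ∀ {φ ψ} → Δ ⊢ φ → Δ ⊢ φ ∨ᶠ ψ
  ∨-introˡ {φ} {ψ} ⊢φ = mp ⊢φ (ax (A3 φ ψ))

  ∨-introʳ : ∀ {φ ψ} → Δ ⊢ ψ → Δ ⊢ φ ∨ᶠ ψ
  ∨-introʳ {φ} {ψ} ⊢ψ = mp ⊢ψ (ax (A4 φ ψ))

  ∨-elim : ∀ {φ ψ χ} → Δ ⊢ φ ∨ᶠ ψ → φ ∷ Δ ⊢ χ → ψ ∷ Δ ⊢ χ → Δ ⊢ χ
  ∨-elim {φ} {ψ} {χ} ⊢φ∨ψ φ⊢χ ψ⊢χ =
    mp ⊢φ∨ψ (mp (deduction ψ⊢χ) (mp (deduction φ⊢χ) (ax (A5 φ ψ χ))))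

module Lindenbaum (Γ : FormulaSet) where

  infix 3.5 _≤ᴸ_ _≈ᴸ_

  _≤ᴸ_ _≈ᴸ_ : Formula → Formula → Set
  φ ≤ᴸ ψ = Γ ⊢ₛ φ ⇒ ψ
  φ ≈ᴸ ψ = Γ ⊢ₛ φ ⇔ᶠ ψ

  private
    by₀ : ∀ {φ} → [] ⊢ φ → Γ ⊢ₛ φ
    by₀ = instantiate []

    by₁ : ∀ {φ ψ} → Γ ⊢ₛ φ → φ ∷ [] ⊢ ψ → Γ ⊢ₛ ψ
    by₁ ⊢φ = instantiate (⊢φ ∷ [])

    by₂ : ∀ {φ ψ χ} → Γ ⊢ₛ φ → Γ ⊢ₛ ψ → ψ ∷ φ ∷ [] ⊢ χ → Γ ⊢ₛ χ
    by₂ ⊢φ ⊢ψ = instantiate (⊢ψ ∷ ⊢φ ∷ [])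

  ≤ᴸ-antisym : ∀ {φ ψ} → φ ≤ᴸ ψ → ψ ≤ᴸ φ → φ ≈ᴸ ψ
  ≤ᴸ-antisym φ≤ψ ψ≤φ = by₂ φ≤ψ ψ≤φ (∧-intro hyp₁ hyp₀)

  ≈ᴸ⇒≤ᴸ : ∀ {φ ψ} → φ ≈ᴸ ψ → φ ≤ᴸ ψ
  ≈ᴸ⇒≤ᴸ φ≈ψ = by₁ φ≈ψ (∧-elimˡ hyp₀)

  ≈ᴸ⇒≥ᴸ : ∀ {φ ψ} → φ ≈ᴸ ψ → ψ ≤ᴸ φ
  ≈ᴸ⇒≥ᴸ φ≈ψ = by₁ φ≈ψ (∧-elimʳ hyp₀)

  ≤ᴸ-refl : ∀ {φ} → φ ≤ᴸ φ
  ≤ᴸ-refl = by₀ ⇒-refl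

  ≤ᴸ-trans : ∀ {φ ψ χ} → φ ≤ᴸ ψ → ψ ≤ᴸ χ → φ ≤ᴸ χ
  ≤ᴸ-trans φ≤ψ ψ≤χ = by₂ φ≤ψ ψ≤χ (deduction (⇒-elim hyp₁ (⇒-elim hyp₂ hyp₀)))

  exponential : ∀ φ ψ χ → φ ∧ᶠ ψ ≤ᴸ χ ⇔ φ ≤ᴸ ψ ⇒ χ
  exponential φ ψ χ = mk⇔
    (λ φ∧ψ≤χ → by₁ φ∧ψ≤χ (deduction (deduction (⇒-elim hyp₂ (∧-intro hyp₁ hyp₀)))))
    (λ φ≤ψ⇒χ → by₁ φ≤ψ⇒χ (deduction (⇒-elim (⇒-elim hyp₁ (∧-elimˡ hyp₀)) (∧-elimʳ hyp₀))))

  coresiduation : ∀ φ ψ χ → φ ≤ᴸ ψ ∨ᶠ χ ⇔ φ ≺ ψ ≤ᴸ χ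
  -- sDN turns φ → ψ ∨ χ into ¬∼(φ → ψ ∨ χ), which refutes (φ ≺ ψ) ≺ χ by A13
  -- and A12; A14 then gives (φ ≺ ψ) → χ.
  coresiduation φ ψ χ = mk⇔
    (λ φ≤ψ∨χ → by₁ (sDN φ≤ψ∨χ) (⇒-elim (ax (A14 (φ ≺ ψ) χ))
      (deduction (⇒-elim hyp₁ (⇒-elim (ax (A12 φ (ψ ∨ᶠ χ))) (⇒-elim (ax (A13 φ ψ χ)) hyp₀))))))
    (λ φ≺ψ≤χ → by₁ φ≺ψ≤χ (deduction
      (∨-elim (⇒-elim (ax (A11 φ ψ)) hyp₀) (∨-introˡ hyp₀) (∨-introʳ (⇒-elim hyp₂ hyp₀)))))

  ≤ᴸ-isPartialOrder : IsPartialOrder _≈ᴸ_ _≤ᴸ_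
  ≤ᴸ-isPartialOrder = record
    { isPreorder = record
      { isEquivalence = record
        { refl = ≤ᴸ-antisym ≤ᴸ-refl ≤ᴸ-refl
        ; sym = λ φ≈ψ → ≤ᴸ-antisym (≈ᴸ⇒≥ᴸ φ≈ψ) (≈ᴸ⇒≤ᴸ φ≈ψ)
        ; trans = λ φ≈ψ ψ≈χ → ≤ᴸ-antisym (≤ᴸ-trans (≈ᴸ⇒≤ᴸ φ≈ψ) (≈ᴸ⇒≤ᴸ ψ≈χ))
                                         (≤ᴸ-trans (≈ᴸ⇒≥ᴸ ψ≈χ) (≈ᴸ⇒≥ᴸ φ≈ψ))
        }
      ; reflexive = ≈ᴸ⇒≤ᴸ
      ; trans = ≤ᴸ-trans
      }
    ; antisym = ≤ᴸ-antisym
    }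

  heytingAlgebraᴸ : HeytingAlgebra 0ℓ 0ℓ 0ℓ
  heytingAlgebraᴸ = record
    { Carrier = Formula
    ; _≈_ = _≈ᴸ_
    ; _≤_ = _≤ᴸ_
    ; _∨_ = _∨ᶠ_
    ; _∧_ = _∧ᶠ_
    ; _⇨_ = _⇒_
    ; ⊤ = ⊤ᶠ
    ; ⊥ = ⊥ᶠ
    ; isHeytingAlgebra = record
      { isBoundedLattice = record
        { isLattice = record
          { isPartialOrder = ≤ᴸ-isPartialOrder
          ; supremum = λ φ ψ → ax (A3 φ ψ) , ax (A4 φ ψ) ,
                               λ χ φ≤χ ψ≤χ → mp ψ≤χ (mp φ≤χ (ax (A5 φ ψ χ)))
          ; infimum = λ φ ψ → ax (A6 φ ψ) , ax (A7 φ ψ) ,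
                              λ χ χ≤φ χ≤ψ → mp χ≤ψ (mp χ≤φ (ax (A8 φ ψ χ)))
          }
        ; maximum = λ φ → ax (A10 φ)
        ; minimum = λ φ → ax (A9 φ)
        }
      ; exponential = λ φ ψ χ → let open Equivalence (exponential φ ψ χ) in to , from
      }
    }

  lindenbaum : BiHeytingAlgebra 0ℓ 0ℓ
  lindenbaum = BiHeyting.biHeytingAlgebra heytingAlgebraᴸ _≺_ coresiduation

  ⟦⟧-var : ∀ φ → ⟦ lindenbaum ⟧ φ var ≡ φ
  ⟦⟧-var (var p)  = ≡.refl
  ⟦⟧-var ⊥ᶠ       = ≡.refl
  ⟦⟧-var ⊤ᶠ       = ≡.refl
  ⟦⟧-var (φ ∧ᶠ ψ) = cong₂ _∧ᶠ_ (⟦⟧-var φ) (⟦⟧-var ψ)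
  ⟦⟧-var (φ ∨ᶠ ψ) = cong₂ _∨ᶠ_ (⟦⟧-var φ) (⟦⟧-var ψ)
  ⟦⟧-var (φ ⇒ ψ)  = cong₂ _⇒_ (⟦⟧-var φ) (⟦⟧-var ψ)
  ⟦⟧-var (φ ≺ ψ)  = cong₂ _≺_ (⟦⟧-var φ) (⟦⟧-var ψ)

  ⟦⟧-var-≈ : ∀ φ ψ → (⟦ lindenbaum ⟧ φ var ≈ᴸ ⟦ lindenbaum ⟧ ψ var) ⇔ (φ ≈ᴸ ψ)
  ⟦⟧-var-≈ φ ψ rewrite ⟦⟧-var φ | ⟦⟧-var ψ = ⇔-id _

equational-soundness : ∀ Θ ε δ → biconds Θ ⊢ₛ ε ⇔ᶠ δ → Θ ⊨BHA ε ≐ δ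
equational-soundness Θ ε δ ⊢ε⇔δ A v v⊨Θ =
  Equivalence.to ⊤≤x⇔y⇔x≈y (soundness A v valid-biconds ⊢ε⇔δ)
  where
  open HeytingAlgebra (heytingAlgebra A) using (_≤_; ⊤)
  open Heyting (heytingAlgebra A) using (⊤≤x⇔y⇔x≈y)

  valid-biconds : ∀ {φ} → biconds Θ φ → ⊤ ≤ ⟦ A ⟧ φ v
  valid-biconds (θ , η , θ≐η , ≡.refl) = Equivalence.from ⊤≤x⇔y⇔x≈y (v⊨Θ θ η θ≐η)

equational-completeness : ∀ Θ ε δ → Θ ⊨BHA ε ≐ δ → biconds Θ ⊢ₛ ε ⇔ᶠ δ
equational-completeness Θ ε δ Θ⊨ε≐δ = to (⟦⟧-var-≈ ε δ) (Θ⊨ε≐δ lindenbaum var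
  λ θ η θ≐η → from (⟦⟧-var-≈ θ η) (el (θ , η , θ≐η , ≡.refl)))
  where
  open Lindenbaum (biconds Θ)
  open Equivalence

mainTheorem17 : (Θ : EquationSet) (ε δ : Formula) →
    (Θ ⊨BHA ε ≐ δ) ⇔ (biconds Θ ⊢ₛ (ε ⇔ᶠ δ))
mainTheorem17 Θ ε δ = mk⇔ (equational-completeness Θ ε δ) (equational-soundness Θ ε δ)
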